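{- Let $L$ be a finite lattice and let $M\subseteq L$ be a sublattice containing the least and greatest elements of $L$. Let $c_M(x)=\bigwedge\{y\in M\mid x\leq y\}$ and $i_M(x)=\bigvee\{y\in M\mid y\leq x\}$ for $x\in L$. Then every mapping $f\colon M\to M$ preserving arbitrary suprema is of the form $f(x)=c_M(F(x))$ for all $x\in M$, for some mapping $F\colon L\to L$ preserving arbitrary suprema. In this case the upper adjoint $g\colon M\to M$ of $f$ is given by $g(y)=i_M(G(y))$ for all $y\in M$, where $G\colon L\to L$ is the upper adjoint of $F$.
   Context: A mapping preserving arbitrary suprema maps the join of any subset (including the empty set, whose join is the least element) to the join of its image. For posets $P,Q$, maps $f\colon P\to Q$, $g\colon Q\to P$ form a monotone Galois connection if $f(x)\leq y\iff x\leq g(y)$ for all $x\in P,y\in Q$; $g$ is then the upper adjoint of $f$. -}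

module Defs where

open import Data.Nat using (ℕ)
open import Data.Fin using (Fin)
open import Data.Fin.Subset using (Subset; _∈_)
open import Data.Product using (Σ; ∃; _×_; proj₁)
open import Relation.Binary.PropositionalEquality using (_≡_)
open import Relation.Binary.Lattice using (IsLattice)
open import Function.Bundles using (_⇔_)

module _ {A : Set} (_≤_ : A → A → Set) where

  IsUpperBound : (A → Set) → A → Set
  IsUpperBound S u = ∀ y → S y → y ≤ u

  IsLowerBound : (A → Set) → A → Set
  IsLowerBound S l = ∀ y → S y → l ≤ y

  IsSup : (A → Set) → A → Set
  IsSup S x = IsUpperBound S x × (∀ u → IsUpperBound S u → x ≤ u)

  IsInf : (A → Set) → A → Set
  IsInf S x = IsLowerBound S x × (∀ l → IsLowerBound S l → l ≤ x)

  Image : (A → A) → (A → Set) → A → Set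
  Image f S b = ∃ λ a → S a × f a ≡ b

  PreservesSups : (A → A) → Set₁
  PreservesSups f = ∀ (S : A → Set) x → IsSup S x → IsSup (Image f S) (f x)

  UpperAdjoint : (A → A) → (A → A) → Set
  UpperAdjoint f g = ∀ x y → (f x ≤ y) ⇔ (x ≤ g y)

-- A finite lattice: carrier Fin n (any finite lattice is isomorphic to one
-- of these), equality _≡_, an order-theoretic lattice structure.

record FiniteLattice (n : ℕ) : Set₁ where
  field
    _≤_ : Fin n → Fin n → Set
    _∨_ : Fin n → Fin n → Fin n
    _∧_ : Fin n → Fin n → Fin n
    isLattice : IsLattice _≡_ _≤_ _∨_ _∧_

module _ {n : ℕ} (L : FiniteLattice n) where
  open FiniteLattice L

  record IsBoundedSublattice (M : Subset n) : Set where
    field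
      ∨-closed : ∀ x y → x ∈ M → y ∈ M → (x ∨ y) ∈ M
      ∧-closed : ∀ x y → x ∈ M → y ∈ M → (x ∧ y) ∈ M
      least∈M    : ∀ b → (∀ x → b ≤ x) → b ∈ M
      greatest∈M : ∀ t → (∀ x → x ≤ t) → t ∈ M

  Elem : Subset n → Set
  Elem M = Σ (Fin n) (_∈ M)

  IsCM : Subset n → Fin n → Fin n → Set
  IsCM M x z = IsInf _≤_ (λ y → y ∈ M × x ≤ y) z

  IsIM : Subset n → Fin n → Fin n → Set
  IsIM M x z = IsSup _≤_ (λ y → y ∈ M × y ≤ x) z

-- The finite lattice M has all joins, so f has an upper adjoint f⁺ on M.  As c_M is
-- lower and i_M upper adjoint to the inclusion M ⊆ L, the maps F = f ∘ c_M and
-- G = f⁺ ∘ i_M form a Galois connection on L; hence F preserves suprema, and F agrees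
-- with f on M because c_M fixes M.  Conversely, for m ∈ M the chain
-- m ≤ G y ⇔ F m ≤ y ⇔ f m ≤ y ⇔ m ≤ g y shows that g y is the largest element of M
-- below G y.
module Submission where

open import Defs
open import Data.Fin using (Fin)
open import Data.Fin.Subset using (Subset)
open import Data.Product using (Σ; _×_; proj₁)

open import Level using (0ℓ)
open import Data.Nat using (ℕ)
open import Data.Fin using (_≟_)
open import Data.Fin.Subset using (_∈_)
open import Data.Fin.Subset.Properties using (_∈?_)
open import Data.List using ([]; _∷_; foldr; filter; allFin)
import Data.List.Membership.Propositional as List
open import Data.List.Membership.Propositional.Properties using (∈-allFin; ∈-filter⁺; ∈-filter⁻)
open import Data.List.Relation.Unary.Any using (here; there)
open import Data.Product using (_,_; proj₂)
open import Data.Sum using (_⊎_; inj₁; inj₂)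
open import Data.Unit using (⊤; tt)
open import Function.Base using (flip; id; _∘_)
open import Function.Bundles using (_⇔_; mk⇔; Equivalence)
open import Function.Properties.Equivalence using (⇔-setoid)
open import Relation.Binary.Definitions using (Decidable)
open import Relation.Binary.Lattice using (IsLattice)
open import Relation.Binary.PropositionalEquality using (_≡_; refl; subst)
import Relation.Binary.Lattice.Properties.Lattice as LatticeProperties
import Relation.Binary.Reasoning.Setoid as ≈-Reasoning
open import Relation.Nullary using (yes; no; _×-dec_)
import Relation.Unary as U

open Equivalence using (to; from)

module _ {A : Set} {_≤_ : A → A → Set}
         (≤-refl : ∀ {x} → x ≤ x) (≤-trans : ∀ {x y z} → x ≤ y → y ≤ z → x ≤ z) where

  preservesSups⇒monotone : ∀ {f} → PreservesSups _≤_ f → ∀ {a b} → a ≤ b → f a ≤ f b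
  preservesSups⇒monotone {f} f-sups {a} {b} a≤b = proj₁ (f-sups pair b pair-sup) (f a) (a , inj₁ refl , refl)
    where
    pair : A → Set
    pair x = x ≡ a ⊎ x ≡ b
    pair-sup : IsSup _≤_ pair b
    pair-sup = (λ { _ (inj₁ refl) → a≤b ; _ (inj₂ refl) → ≤-refl }) , λ u ub → ub b (inj₂ refl)

  upperAdjoint⇒preservesSups : ∀ {f g} → UpperAdjoint _≤_ f g → PreservesSups _≤_ f
  upperAdjoint⇒preservesSups {f} {g} f⊣g S x (x-ub , x-least) = fx-ub , fx-least
    where
    fx-ub : IsUpperBound _≤_ (Image _≤_ f S) (f x)
    fx-ub _ (s , s∈S , refl) = from (f⊣g s (f x)) (≤-trans (x-ub s s∈S) (to (f⊣g x (f x)) ≤-refl))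
    fx-least : ∀ u → IsUpperBound _≤_ (Image _≤_ f S) u → f x ≤ u
    fx-least u u-ub = from (f⊣g x u) (x-least (g u) λ s s∈S → to (f⊣g s u) (u-ub (f s) (s , s∈S , refl)))

module _ {n : ℕ} where

  dual : FiniteLattice n → FiniteLattice n
  dual L = record
    { _≤_ = flip _≤_ ; _∨_ = _∧_ ; _∧_ = _∨_
    ; isLattice = LatticeProperties.∧-∨-isLattice (record { isLattice = isLattice }) }
    where open FiniteLattice L

  dual-isBoundedSublattice : ∀ {L M} → IsBoundedSublattice L M → IsBoundedSublattice (dual L) M
  dual-isBoundedSublattice BS = record
    { ∨-closed = ∧-closed ; ∧-closed = ∨-closed ; least∈M = greatest∈M ; greatest∈M = least∈M }
    where open IsBoundedSublattice BS

module FiniteJoins {n : ℕ} (L : FiniteLattice n) where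
  open FiniteLattice L
  open IsLattice isLattice using (antisym; x≤x∨y; y≤x∨y; ∨-least) renaming (refl to ≤-refl; trans to ≤-trans)

  _≤?_ : Decidable _≤_
  x ≤? y with (x ∨ y) ≟ y
  ... | yes x∨y≡y = yes (subst (x ≤_) x∨y≡y (x≤x∨y x y))
  ... | no  x∨y≢y = no λ x≤y → x∨y≢y (antisym (∨-least x≤y ≤-refl) (y≤x∨y x y))

  ≤-foldr : ∀ {t b ts} → t List.∈ ts → t ≤ foldr _∨_ b ts
  ≤-foldr {ts = s ∷ _} (here refl)  = x≤x∨y s _
  ≤-foldr {ts = s ∷ _} (there t∈ts) = ≤-trans (≤-foldr t∈ts) (y≤x∨y s _)

  foldr-least : ∀ {b u} ts → b ≤ u → (∀ {t} → t List.∈ ts → t ≤ u) → foldr _∨_ b ts ≤ u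
  foldr-least []       b≤u ts≤u = b≤u
  foldr-least (s ∷ ts) b≤u ts≤u = ∨-least (ts≤u (here refl)) (foldr-least ts b≤u (ts≤u ∘ there))

  foldr-closed : ∀ {Q : Fin n → Set} → (∀ {x y} → Q x → Q y → Q (x ∨ y)) →
                 ∀ {b} ts → Q b → (∀ {t} → t List.∈ ts → Q t) → Q (foldr _∨_ b ts)
  foldr-closed ∨-closed []       Qb Qts = Qb
  foldr-closed ∨-closed (s ∷ ts) Qb Qts = ∨-closed (Qts (here refl)) (foldr-closed ∨-closed ts Qb (Qts ∘ there))

  ⨆ : {P : Fin n → Set} → U.Decidable P → Fin n → Fin n
  ⨆ P? b = foldr _∨_ b (filter P? (allFin n))

  module _ {P : Fin n → Set} (P? : U.Decidable P) where
    private
      satisfies : ∀ {t} → t List.∈ filter P? (allFin n) → P t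
      satisfies = proj₂ ∘ ∈-filter⁻ P? {xs = allFin n}

    ≤-⨆ : ∀ {b t} → P t → t ≤ ⨆ P? b
    ≤-⨆ {t = t} Pt = ≤-foldr (∈-filter⁺ P? (∈-allFin t) Pt)

    ⨆-least : ∀ {b u} → b ≤ u → (∀ t → P t → t ≤ u) → ⨆ P? b ≤ u
    ⨆-least b≤u P≤u = foldr-least (filter P? (allFin n)) b≤u (P≤u _ ∘ satisfies)

    ⨆-closed : ∀ {Q : Fin n → Set} → (∀ {x y} → Q x → Q y → Q (x ∨ y)) →
               ∀ {b} → Q b → (∀ t → P t → Q t) → Q (⨆ P? b)
    ⨆-closed ∨-closed Qb P⊆Q = foldr-closed ∨-closed (filter P? (allFin n)) Qb (P⊆Q _ ∘ satisfies)

  -- Fin n may be empty, so the greatest element is built from a given element.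
  top : Fin n → Fin n
  top = ⨆ {P = λ _ → ⊤} (λ _ → yes tt)

  ≤-top : ∀ x y → y ≤ top x
  ≤-top x y = ≤-⨆ (λ _ → yes tt) tt

module _ {n : ℕ} (L : FiniteLattice n) (M : Subset n) where
  open FiniteLattice L
  open IsLattice isLattice using () renaming (refl to ≤-refl; trans to ≤-trans)

  isCM⇒≤⇔ : ∀ {x z t} → IsCM L M x z → t ∈ M → (z ≤ t ⇔ x ≤ t)
  isCM⇒≤⇔ (z-lb , z-greatest) t∈M =
    mk⇔ (≤-trans (z-greatest _ λ _ → proj₂)) (λ x≤t → z-lb _ (t∈M , x≤t))

  ≤⇔⇒isCM : ∀ {x z} → z ∈ M → (∀ {t} → t ∈ M → (z ≤ t ⇔ x ≤ t)) → IsCM L M x z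
  ≤⇔⇒isCM z∈M z≤⇔x≤ = (λ t (t∈M , x≤t) → from (z≤⇔x≤ t∈M) x≤t)
                     , λ l l-lb → l-lb _ (z∈M , to (z≤⇔x≤ z∈M) ≤-refl)

module InducedOrder {n : ℕ} (L : FiniteLattice n) (M : Subset n) where
  open FiniteLattice L

  _≤ᴹ_ : Elem L M → Elem L M → Set
  a ≤ᴹ b = proj₁ a ≤ proj₁ b

-- IsIM L M is IsCM (dual L) M on the nose.
module _ {n : ℕ} (L : FiniteLattice n) (M : Subset n) where
  open FiniteLattice L

  isIM⇒≤⇔ : ∀ {x z t} → IsIM L M x z → t ∈ M → (t ≤ z ⇔ t ≤ x)
  isIM⇒≤⇔ = isCM⇒≤⇔ (dual L) M

  ≤⇔⇒isIM : ∀ {x z} → z ∈ M → (∀ {t} → t ∈ M → (t ≤ z ⇔ t ≤ x)) → IsIM L M x z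
  ≤⇔⇒isIM = ≤⇔⇒isCM (dual L) M

module BoundedSublattice {n : ℕ} (L : FiniteLattice n) {M : Subset n} (BS : IsBoundedSublattice L M) where
  open FiniteLattice L
  open IsLattice isLattice using () renaming (refl to ≤-refl; trans to ≤-trans)
  open IsBoundedSublattice BS
  open InducedOrder L M
  open FiniteJoins L using (_≤?_; ⨆; ≤-⨆; ⨆-least; ⨆-closed; top; ≤-top)
  open FiniteJoins (dual L) using ()
    renaming (⨆ to ⨅; ≤-⨆ to ⨅-≤; ⨆-least to ⨅-greatest; ⨆-closed to ⨅-closed; top to bot; ≤-top to bot-≤)

  Above : Fin n → Fin n → Set
  Above x t = t ∈ M × x ≤ t

  above? : ∀ x → U.Decidable (Above x)
  above? x t = t ∈? M ×-dec x ≤? t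

  c : Fin n → Fin n
  c x = ⨅ (above? x) (top x)

  c∈M : ∀ x → c x ∈ M
  c∈M x = ⨅-closed (above? x) (∧-closed _ _) (greatest∈M _ (≤-top x)) λ _ → proj₁

  c-isCM : ∀ x → IsCM L M x (c x)
  c-isCM x = (λ _ → ⨅-≤ (above? x))
           , λ l l-lb → ⨅-greatest (above? x) (l-lb _ (greatest∈M _ (≤-top x) , ≤-top x x)) l-lb

  module UpperAdjointOf {f : Elem L M → Elem L M} (f-sups : PreservesSups _≤ᴹ_ f) where
    f-mono : ∀ {a b} → a ≤ᴹ b → f a ≤ᴹ f b
    f-mono = preservesSups⇒monotone ≤-refl ≤-trans f-sups

    Below : Elem L M → Fin n → Set
    Below y t = Σ (t ∈ M) λ t∈M → f (t , t∈M) ≤ᴹ y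

    -- Independence of the membership proof follows from monotonicity of f.
    below? : ∀ y → U.Decidable (Below y)
    below? y t with t ∈? M
    ... | no t∉M = no λ (t∈M , _) → t∉M t∈M
    ... | yes t∈M with proj₁ (f (t , t∈M)) ≤? proj₁ y
    ...   | yes ft≤y = yes (t∈M , ft≤y)
    ...   | no  ft≰y = no λ (_ , ft≤y) → ft≰y (≤-trans (f-mono ≤-refl) ft≤y)

    f⁺ : Elem L M → Elem L M
    f⁺ y = ⨆ (below? y) (bot (proj₁ y))
         , ⨆-closed (below? y) (∨-closed _ _) (least∈M _ (bot-≤ (proj₁ y))) λ _ → proj₁

    f⁺-isSup : ∀ y → IsSup _≤ᴹ_ (λ a → f a ≤ᴹ y) (f⁺ y)
    f⁺-isSup y = (λ (t , t∈M) ft≤y → ≤-⨆ (below? y) (t∈M , ft≤y))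
               , λ (u , _) u-ub → ⨆-least (below? y) (bot-≤ (proj₁ y) u)
                                    λ t (t∈M , ft≤y) → u-ub (t , t∈M) ft≤y

    f⊣f⁺ : UpperAdjoint _≤ᴹ_ f f⁺
    f⊣f⁺ a y = mk⇔ (proj₁ (f⁺-isSup y) a) λ a≤f⁺y → ≤-trans (f-mono {a} {f⁺ y} a≤f⁺y) f[f⁺y]≤y
      where
      f[f⁺y]≤y : f (f⁺ y) ≤ᴹ y
      f[f⁺y]≤y = proj₂ (f-sups _ _ (f⁺-isSup y)) y λ { _ (_ , fb≤y , refl) → fb≤y }

module Extension {n : ℕ} (L : FiniteLattice n) {M : Subset n} (BS : IsBoundedSublattice L M)
                 {f : Elem L M → Elem L M} (f-sups : PreservesSups (InducedOrder._≤ᴹ_ L M) f) where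
  open FiniteLattice L
  open IsLattice isLattice using (antisym) renaming (refl to ≤-refl; trans to ≤-trans)
  open BoundedSublattice L BS using (c; c∈M; c-isCM; module UpperAdjointOf)
  open BoundedSublattice (dual L) (dual-isBoundedSublattice BS) using ()
    renaming (c to i; c∈M to i∈M; c-isCM to i-isIM)
  open UpperAdjointOf f-sups using (f⁺; f⊣f⁺; f-mono)

  F : Fin n → Fin n
  F x = proj₁ (f (c x , c∈M x))

  G : Fin n → Fin n
  G u = proj₁ (f⁺ (i u , i∈M u))

  F⊣G : UpperAdjoint _≤_ F G
  F⊣G x u = begin
    F x ≤ u    ≈⟨ isIM⇒≤⇔ L M (i-isIM u) (proj₂ (f _)) ⟨
    F x ≤ i u  ≈⟨ f⊣f⁺ _ _ ⟩
    c x ≤ G u  ≈⟨ isCM⇒≤⇔ L M (c-isCM x) (proj₂ (f⁺ _)) ⟩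
    x ≤ G u    ∎
    where open ≈-Reasoning (⇔-setoid 0ℓ)

  F-preservesSups : PreservesSups _≤_ F
  F-preservesSups = upperAdjoint⇒preservesSups ≤-refl ≤-trans F⊣G

  F-extends-f : ∀ x → F (proj₁ x) ≡ proj₁ (f x)
  F-extends-f (t , t∈M) = antisym (f-mono c[t]≤t) (f-mono t≤c[t])
    where
    c[t]≤t : c t ≤ t
    c[t]≤t = from (isCM⇒≤⇔ L M (c-isCM t) t∈M) ≤-refl
    t≤c[t] : t ≤ c t
    t≤c[t] = to (isCM⇒≤⇔ L M (c-isCM t) (c∈M t)) ≤-refl

  F-isCM-f : ∀ x → IsCM L M (F (proj₁ x)) (proj₁ (f x))
  F-isCM-f x rewrite F-extends-f x = ≤⇔⇒isCM L M (proj₂ (f x)) λ _ → mk⇔ id id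

module _ {n : ℕ} (L : FiniteLattice n) (M : Subset n) where
  open FiniteLattice L
  open InducedOrder L M

  upperAdjoint-isIM : ∀ {f : Elem L M → Elem L M} {F} → (∀ x → IsCM L M (F (proj₁ x)) (proj₁ (f x))) →
                      ∀ {G} → UpperAdjoint _≤_ F G → ∀ {g} → UpperAdjoint _≤ᴹ_ f g →
                      ∀ y → IsIM L M (G (proj₁ y)) (proj₁ (g y))
  upperAdjoint-isIM {f} {F} F-isCM-f {G} F⊣G {g} f⊣g y@(u , u∈M) =
    ≤⇔⇒isIM L M (proj₂ (g y)) λ {t} t∈M → begin
      t ≤ proj₁ (g y)          ≈⟨ f⊣g (t , t∈M) y ⟨
      proj₁ (f (t , t∈M)) ≤ u  ≈⟨ isCM⇒≤⇔ L M (F-isCM-f (t , t∈M)) u∈M ⟩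
      F t ≤ u                  ≈⟨ F⊣G t u ⟩
      t ≤ G u                  ∎
    where open ≈-Reasoning (⇔-setoid 0ℓ)

lemma2 : ∀ {n} (L : FiniteLattice n) (M : Subset n) → IsBoundedSublattice L M →
    let open FiniteLattice L
        _≤M_ : Elem L M → Elem L M → Set
        _≤M_ a b = proj₁ a ≤ proj₁ b
    in (f : Elem L M → Elem L M) → PreservesSups _≤M_ f →
       (Σ (Fin n → Fin n) λ F → PreservesSups _≤_ F
          × (∀ x → IsCM L M (F (proj₁ x)) (proj₁ (f x))))
       × (∀ (F : Fin n → Fin n) → PreservesSups _≤_ F
          → (∀ x → IsCM L M (F (proj₁ x)) (proj₁ (f x)))
          → ∀ (G : Fin n → Fin n) → UpperAdjoint _≤_ F G
          → ∀ (g : Elem L M → Elem L M) → UpperAdjoint _≤M_ f g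
          → ∀ y → IsIM L M (G (proj₁ y)) (proj₁ (g y)))
lemma2 L M BS f f-sups =
    (F , F-preservesSups , F-isCM-f)
  , λ F _ F-isCM-f G F⊣G g f⊣g → upperAdjoint-isIM L M {f} {F} F-isCM-f {G} F⊣G {g} f⊣g
  where open Extension L BS f-sups
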